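{- Let $S$ be a confluent fragment of $\lambda_{lin}^{\to}$, viewed as a fragment of $\lambda_{lin}^{=}$. For every term $M\in S$ and every value $V$: if $M\to^{=*}_{\ell\cup\beta}V$ (algebraic equality restricted to $S$), then there is a value $V'$ with $M\to^{*}_{\ell\cup\beta}V'$ and $V(\to^{=}_\ell)^{*}V'$ (algebraic equality restricted to $S$).
   Context: Fix a ring of scalars (elements $\alpha,\beta$). Terms, values and base terms are given by: $M,N,L ::= V \mid (M)~N \mid \alpha.M \mid M+N$ (terms); $U,V,W ::= 0 \mid B \mid \alpha.V \mid V+W$ (values); $B ::= x \mid \lambda x\,M$ (base terms). $M[x:=N]$ is capture-avoiding substitution. Below $V$ is a value and $B$ a base term. Rewrite rules: $(\beta_v)$ $(\lambda x\,M)~B\to M[x:=B]$. $(A_l)$ $(M+N)~V\to(M)~V+(N)~V$; $(\alpha.M)~V\to\alpha.(M)~V$; $(0)~V\to 0$. $(A_r)$ $(B)~(M+N)\to(B)~M+(B)~N$; $(B)~(\alpha.M)\to\alpha.(B)~M$; $(B)~0\to 0$. (Asso) $M+(N+L)\to(M+N)+L$ and $(M+N)+L\to M+(N+L)$. (Com) $M+N\to N+M$. $(F)$ $\alpha.M+\beta.M\to(\alpha+\beta).M$; $\alpha.M+M\to(\alpha+1).M$; $M+M\to(1+1).M$; $\alpha.(\beta.M)\to(\alpha\beta).M$. $(S)$ $\alpha.(M+N)\to\alpha.M+\alpha.N$; $1.M\to M$; $0.M\to 0$; $\alpha.0\to 0$; $0+M\to M$. Context rules $(\xi)$: from $M\to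 M'$ infer $(M)~N\to(M')~N$, $M+N\to M'+N$, $N+M\to N+M'$, $\alpha.M\to\alpha.M'$. Context rule $(\xi_{lin})$: from $M\to M'$ infer $(V)~M\to(V)~M'$ for $V$ a value. Let $L=\mathrm{Asso}\cup\mathrm{Com}\cup F\cup S$. $\to_\ell$ is generated by $A_l\cup A_r\cup L$ closed under $\xi,\xi_{lin}$; $\to_{\beta_v}$ is generated by $\beta_v$ closed under $\xi,\xi_{lin}$; $\to_{\ell\cup\beta}:=\to_\ell\cup\to_{\beta_v}$ (language $\lambda_{lin}^{\to}$). $R^{*}$ is reflexive-transitive closure. A fragment of $\lambda_{lin}^{\to}$ is a set $S$ of terms closed under $\to_{\ell\cup\beta}$, with the relation restricted to $S$; it is confluent if $\to_{\ell\cup\beta}$ restricted to $S$ is confluent. As a fragment of $\lambda_{lin}^{=}$, $S$ carries the restricted algebraic equality: $M\to^{=}_\ell N$ iff $M,N\in S$ and ($M\to_\ell N$ or $N\to_\ell M$); and $\to^{=}_{\ell\cup\beta}$ is this relation union $\to_{\beta_v}$. -}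

module Defs where

open import Level using (Level; _⊔_) renaming (suc to lsuc)
open import Data.Nat using (ℕ; zero; suc)
open import Data.Product using (Σ; _×_; _,_)
open import Data.Sum using (_⊎_)
open import Relation.Binary.PropositionalEquality using (_≡_)
open import Relation.Binary.Construct.Closure.ReflexiveTransitive using (Star)
open import Algebra.Core using (Op₁; Op₂)
open import Algebra.Structures using (IsRing)

record Scalars (c : Level) : Set (lsuc c) where
  field
    Carrier : Set c
    _+_ _*_ : Op₂ Carrier
    -_      : Op₁ Carrier
    0# 1#   : Carrier
    isRing  : IsRing _≡_ _+_ _*_ -_ 0# 1#

module Lambda {c : Level} (K : Scalars c) where
  open Scalars K renaming (_+_ to _+ₛ_; _*_ to _*ₛ_)

  -- Terms, with variables as de Bruijn indices (so substitution is
  -- capture-avoiding by construction).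
  --   var n     : variable      lam M   : λ-abstraction
  --   app M N   : (M) N         𝟘       : the null vector 0
  --   α · M     : scalar mult.
  infixl 6 _⊕_
  infixr 7 _·_
  data Term : Set c where
    var : ℕ → Term
    lam : Term → Term
    app : Term → Term → Term
    𝟘   : Term
    _·_ : Carrier → Term → Term
    _⊕_ : Term → Term → Term

  data IsBase : Term → Set c where
    var : ∀ n → IsBase (var n)
    lam : ∀ M → IsBase (lam M)

  data IsValue : Term → Set c where
    zero : IsValue 𝟘
    base : ∀ {B} → IsBase B → IsValue B
    smul : ∀ α {V} → IsValue V → IsValue (α · V)
    add  : ∀ {V W} → IsValue V → IsValue W → IsValue (V ⊕ W)

  ext : (ℕ → ℕ) → ℕ → ℕ
  ext ρ zero    = zero
  ext ρ (suc n) = suc (ρ n)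

  rename : (ℕ → ℕ) → Term → Term
  rename ρ (var n)   = var (ρ n)
  rename ρ (lam M)   = lam (rename (ext ρ) M)
  rename ρ (app M N) = app (rename ρ M) (rename ρ N)
  rename ρ 𝟘         = 𝟘
  rename ρ (α · M)   = α · rename ρ M
  rename ρ (M ⊕ N)   = rename ρ M ⊕ rename ρ N

  exts : (ℕ → Term) → ℕ → Term
  exts σ zero    = var zero
  exts σ (suc n) = rename suc (σ n)

  subst : (ℕ → Term) → Term → Term
  subst σ (var n)   = σ n
  subst σ (lam M)   = lam (subst (exts σ) M)
  subst σ (app M N) = app (subst σ M) (subst σ N)
  subst σ 𝟘         = 𝟘
  subst σ (α · M)   = α · subst σ M
  subst σ (M ⊕ N)   = subst σ M ⊕ subst σ N

  sub0 : Term → ℕ → Term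
  sub0 N zero    = N
  sub0 N (suc n) = var n

  _[0≔_] : Term → Term → Term
  M [0≔ N ] = subst (sub0 N) M

  data Head-β : Term → Term → Set c where
    βv : ∀ M {B} → IsBase B → Head-β (app (lam M) B) (M [0≔ B ])

  -- Head rules A_l ∪ A_r ∪ L  (L = Asso ∪ Com ∪ F ∪ S)
  data Head-ℓ : Term → Term → Set c where
    Al-add  : ∀ M N {V} → IsValue V → Head-ℓ (app (M ⊕ N) V) (app M V ⊕ app N V)
    Al-smul : ∀ α M {V} → IsValue V → Head-ℓ (app (α · M) V) (α · app M V)
    Al-zero : ∀ {V} → IsValue V → Head-ℓ (app 𝟘 V) 𝟘
    Ar-add  : ∀ {B} → IsBase B → ∀ M N → Head-ℓ (app B (M ⊕ N)) (app B M ⊕ app B N)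
    Ar-smul : ∀ {B} → IsBase B → ∀ α M → Head-ℓ (app B (α · M)) (α · app B M)
    Ar-zero : ∀ {B} → IsBase B → Head-ℓ (app B 𝟘) 𝟘
    asso₁ : ∀ M N L → Head-ℓ (M ⊕ (N ⊕ L)) ((M ⊕ N) ⊕ L)
    asso₂ : ∀ M N L → Head-ℓ ((M ⊕ N) ⊕ L) (M ⊕ (N ⊕ L))
    com : ∀ M N → Head-ℓ (M ⊕ N) (N ⊕ M)
    F₁ : ∀ α β M → Head-ℓ (α · M ⊕ β · M) ((α +ₛ β) · M)
    F₂ : ∀ α M → Head-ℓ (α · M ⊕ M) ((α +ₛ 1#) · M)
    F₃ : ∀ M → Head-ℓ (M ⊕ M) ((1# +ₛ 1#) · M)
    F₄ : ∀ α β M → Head-ℓ (α · (β · M)) ((α *ₛ β) · M)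
    S₁ : ∀ α M N → Head-ℓ (α · (M ⊕ N)) (α · M ⊕ α · N)
    S₂ : ∀ M → Head-ℓ (1# · M) M
    S₃ : ∀ M → Head-ℓ (0# · M) 𝟘
    S₄ : ∀ α → Head-ℓ (α · 𝟘) 𝟘
    S₅ : ∀ M → Head-ℓ (𝟘 ⊕ M) M

  data Ctx (R : Term → Term → Set c) : Term → Term → Set c where
    head  : ∀ {M M'} → R M M' → Ctx R M M'
    appL  : ∀ {M M'} N → Ctx R M M' → Ctx R (app M N) (app M' N)
    addL  : ∀ {M M'} N → Ctx R M M' → Ctx R (M ⊕ N) (M' ⊕ N)
    addR  : ∀ {M M'} N → Ctx R M M' → Ctx R (N ⊕ M) (N ⊕ M')
    smul  : ∀ {M M'} α → Ctx R M M' → Ctx R (α · M) (α · M')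
    appR  : ∀ {M M' V} → IsValue V → Ctx R M M' → Ctx R (app V M) (app V M')

  _→ℓ_ : Term → Term → Set c
  _→ℓ_ = Ctx Head-ℓ

  _→β_ : Term → Term → Set c
  _→β_ = Ctx Head-β

  _→ℓβ_ : Term → Term → Set c
  M →ℓβ N = (M →ℓ N) ⊎ (M →β N)

  module Fragment {ℓ : Level} (S : Term → Set ℓ) where
    IsFragment : Set (c ⊔ ℓ)
    IsFragment = ∀ {M N} → S M → M →ℓβ N → S N

    _→S_ : Term → Term → Set (c ⊔ ℓ)
    M →S N = S M × S N × (M →ℓβ N)

    _→S*_ : Term → Term → Set (c ⊔ ℓ)
    _→S*_ = Star _→S_

    Confluent : Set (c ⊔ ℓ)
    Confluent = ∀ {M N₁ N₂} → M →S* N₁ → M →S* N₂ →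
                Σ Term (λ L → (N₁ →S* L) × (N₂ →S* L))

    _→=ℓ_ : Term → Term → Set (c ⊔ ℓ)
    M →=ℓ N = S M × S N × ((M →ℓ N) ⊎ (N →ℓ M))

    _→=ℓβ_ : Term → Term → Set (c ⊔ ℓ)
    M →=ℓβ N = (M →=ℓ N) ⊎ (S M × S N × (M →β N))

-- Confluence of →S makes every zig-zag of →S-steps joinable (Church–Rosser),
-- and each →^=_{ℓ∪β}-step is a →S-step in one of the two directions, so M and V
-- have a common →S-reduct V'. Values contain no redex of A_l, A_r or β_v, so a
-- reduction out of a value uses only L-steps and stays among values: V' is a
-- value, and the reduction V →S* V' is an algebraic equality.
module Submission where

open import Defs
open import Level using (Level)
open import Data.Product using (Σ; ∃; -,_; _×_; _,_)
open import Data.Sum using (inj₁; inj₂)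
open import Relation.Nullary using (¬_)
open import Relation.Binary.Core using (Rel)
open import Relation.Binary.Construct.Closure.ReflexiveTransitive as Star
  using (Star; ε; _◅_; _◅◅_)
open import Relation.Binary.Construct.Closure.Symmetric using (SymClosure; fwd; bwd)
open import Relation.Binary.Construct.Closure.Equivalence using (EqClosure)
open import Relation.Binary.Rewriting using () renaming (Confluent to Confluent-rel)

module _ {a r} {A : Set a} {_⟶_ : Rel A r} where

  confluent⇒church-rosser : Confluent-rel _⟶_ → ∀ {x y} → EqClosure _⟶_ x y →
                            ∃ λ z → Star _⟶_ x z × Star _⟶_ y z
  confluent⇒church-rosser conf ε = -, ε , ε
  confluent⇒church-rosser conf (fwd x⟶m ◅ m↔y) with confluent⇒church-rosser conf m↔y
  ... | z , m↠z , y↠z = z , x⟶m ◅ m↠z , y↠z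
  confluent⇒church-rosser conf (bwd m⟶x ◅ m↔y) with confluent⇒church-rosser conf m↔y
  ... | z , m↠z , y↠z with conf (m⟶x ◅ ε) m↠z
  ... | w , x↠w , z↠w = w , x↠w , y↠z ◅◅ z↠w

module _ {c : Level} {K : Scalars c} where
  open Lambda K

  Head-ℓ-preserves-IsValue : ∀ {V N} → Head-ℓ V N → IsValue V → IsValue N
  Head-ℓ-preserves-IsValue (Al-add _ _ _)  (base ())
  Head-ℓ-preserves-IsValue (Al-smul _ _ _) (base ())
  Head-ℓ-preserves-IsValue (Al-zero _)     (base ())
  Head-ℓ-preserves-IsValue (Ar-add _ _ _)  (base ())
  Head-ℓ-preserves-IsValue (Ar-smul _ _ _) (base ())
  Head-ℓ-preserves-IsValue (Ar-zero _)     (base ())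
  Head-ℓ-preserves-IsValue (asso₁ _ _ _) (add m (add n l))   = add (add m n) l
  Head-ℓ-preserves-IsValue (asso₂ _ _ _) (add (add m n) l)   = add m (add n l)
  Head-ℓ-preserves-IsValue (com _ _)     (add m n)           = add n m
  Head-ℓ-preserves-IsValue (F₁ _ _ _)    (add (smul _ m) _)  = smul _ m
  Head-ℓ-preserves-IsValue (F₂ _ _)      (add _ m)           = smul _ m
  Head-ℓ-preserves-IsValue (F₃ _)        (add m _)           = smul _ m
  Head-ℓ-preserves-IsValue (F₄ _ _ _)    (smul _ (smul _ m)) = smul _ m
  Head-ℓ-preserves-IsValue (S₁ _ _ _)    (smul α (add m n))  = add (smul α m) (smul α n)
  Head-ℓ-preserves-IsValue (S₂ _)        (smul _ m)          = m
  Head-ℓ-preserves-IsValue (S₃ _)        _                   = zero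
  Head-ℓ-preserves-IsValue (S₄ _)        _                   = zero
  Head-ℓ-preserves-IsValue (S₅ _)        (add _ m)           = m

  →ℓ-preserves-IsValue : ∀ {V N} → V →ℓ N → IsValue V → IsValue N
  →ℓ-preserves-IsValue (head h)   v          = Head-ℓ-preserves-IsValue h v
  →ℓ-preserves-IsValue (addL _ s) (add v w)  = add (→ℓ-preserves-IsValue s v) w
  →ℓ-preserves-IsValue (addR _ s) (add v w)  = add v (→ℓ-preserves-IsValue s w)
  →ℓ-preserves-IsValue (smul α s) (smul _ v) = smul α (→ℓ-preserves-IsValue s v)
  →ℓ-preserves-IsValue (appL _ _) (base ())
  →ℓ-preserves-IsValue (appR _ _) (base ())

  IsValue⇒¬→β : ∀ {V N} → IsValue V → ¬ (V →β N)
  IsValue⇒¬→β (base ())  (head (βv _ _))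
  IsValue⇒¬→β (add v _)  (addL _ s) = IsValue⇒¬→β v s
  IsValue⇒¬→β (add _ w)  (addR _ s) = IsValue⇒¬→β w s
  IsValue⇒¬→β (smul _ v) (smul _ s) = IsValue⇒¬→β v s
  IsValue⇒¬→β (base ())  (appL _ _)
  IsValue⇒¬→β (base ())  (appR _ _)

  module _ {ℓ : Level} {S : Term → Set ℓ} where
    open Fragment S

    →=ℓβ⇒sym→S : ∀ {M N} → M →=ℓβ N → SymClosure _→S_ M N
    →=ℓβ⇒sym→S (inj₁ (sM , sN , inj₁ M→ℓN)) = fwd (sM , sN , inj₁ M→ℓN)
    →=ℓβ⇒sym→S (inj₁ (sM , sN , inj₂ N→ℓM)) = bwd (sN , sM , inj₁ N→ℓM)
    →=ℓβ⇒sym→S (inj₂ (sM , sN , M→βN))      = fwd (sM , sN , inj₂ M→βN)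

    value-reduct : ∀ {V L} → IsValue V → V →S* L → IsValue L × Star _→=ℓ_ V L
    value-reduct v ε = v , ε
    value-reduct v ((_ , _ , inj₂ V→βN) ◅ _) with () ← IsValue⇒¬→β v V→βN
    value-reduct v ((sV , sN , inj₁ V→ℓN) ◅ N↠L)
      with value-reduct (→ℓ-preserves-IsValue V→ℓN v) N↠L
    ... | l , N=L = l , (sV , sN , inj₁ V→ℓN) ◅ N=L

theorem4 : ∀ {c ℓ : Level} (K : Scalars c) →
    let open Lambda K in
    (S : Term → Set ℓ) →
    let open Fragment S in
    IsFragment → Confluent →
    ∀ (M V : Term) → S M → IsValue V →
    Star _→=ℓβ_ M V →
    Σ Term (λ V' → IsValue V' × Star _→S_ M V' × Star _→=ℓ_ V V')
theorem4 K S _ conf M V _ v M=V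
  with confluent⇒church-rosser conf (Star.map →=ℓβ⇒sym→S M=V)
... | V' , M↠V' , V↠V' with value-reduct v V↠V'
... | v' , V=V' = V' , v' , M↠V' , V=V'
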